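{- For any adinkraizable chromotopology $A$, the number of odd dashings equals the number of even dashings: $|o(A)|=|e(A)|$.
   Context: A chromotopology of dimension $n$ is a finite connected simple bipartite $n$-regular graph with edges colored by $[n]$, each vertex incident to exactly one edge of each color, such that for distinct colors $i,j$ the edges of colors $i,j$ form a disjoint union of $4$-cycles (the $2$-colored $4$-cycles). A dashing is a map $d\colon E(A)\to\mathbf{Z}_2$; it is odd (resp. even) if its sum over every $2$-colored $4$-cycle is $1$ (resp. $0$); $o(A)$, $e(A)$ are the sets of odd and even dashings. $A$ is adinkraizable if it admits an odd dashing and a ranking (a function $h\colon V\to\mathbf{Z}$ with $|h(u)-h(w)|=1$ on every edge). -}

module Defs where

open import Data.Nat using (ℕ; zero; suc)
open import Data.Fin using (Fin; zero; suc; _≟_)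
open import Data.Fin.Properties using (all?)
open import Data.Bool using (Bool; true; false; _xor_; if_then_else_)
open import Data.Integer using (ℤ; _-_; ∣_∣)
open import Data.List using (List; []; _∷_; map; _++_; filter; length)
open import Data.Product using (Σ; ∃; _×_; _,_)
open import Data.Sum using (_⊎_)
open import Relation.Nullary using (¬_; Dec; yes; no)
open import Relation.Nullary.Decidable using (⌊_⌋; ¬?; _→-dec_)
open import Relation.Binary.PropositionalEquality using (_≡_; _≢_)
open import Data.Bool.Properties using () renaming (_≟_ to _≟B_)

data Reachable {V E : ℕ} (src tgt : Fin E → Fin V) : Fin V → Fin V → Set where
  here : ∀ {u} → Reachable src tgt u u
  fwd  : ∀ {u w} (e : Fin E) → src e ≡ u → Reachable src tgt (tgt e) w → Reachable src tgt u w
  bwd  : ∀ {u w} (e : Fin E) → tgt e ≡ u → Reachable src tgt (src e) w → Reachable src tgt u w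

Incident : {V E : ℕ} (src tgt : Fin E → Fin V) → Fin V → Fin E → Set
Incident src tgt v e = src e ≡ v ⊎ tgt e ≡ v

-- the endpoint of e other than v (meaningful when v is incident to e)
other : {V E : ℕ} (src tgt : Fin E → Fin V) → Fin E → Fin V → Fin V
other src tgt e v with src e ≟ v
... | yes _ = tgt e
... | no  _ = src e

-- A chromotopology of dimension n.  Vertices are Fin V, edges are Fin E,
-- edge e has endpoints src e, tgt e (orientation irrelevant) and colour col e.
record Chromotopology (n : ℕ) : Set where
  field
    V E      : ℕ
    src tgt  : Fin E → Fin V
    col      : Fin E → Fin n
    loopless : ∀ e → src e ≢ tgt e
    noMulti  : ∀ e f → (src e ≡ src f × tgt e ≡ tgt f) ⊎ (src e ≡ tgt f × tgt e ≡ src f) → e ≡ f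
    edgeAt        : Fin n → Fin V → Fin E
    edgeAt-col    : ∀ i v → col (edgeAt i v) ≡ i
    edgeAt-inc    : ∀ i v → Incident src tgt v (edgeAt i v)
    edgeAt-unique : ∀ i v e → col e ≡ i → Incident src tgt v e → e ≡ edgeAt i v
    bipartite : ∃ λ (c : Fin V → Bool) → ∀ e → c (src e) ≢ c (tgt e)
    -- connected (and nonempty)
    basepoint : Fin V
    connected : ∀ u w → Reachable src tgt u w

  step : Fin n → Fin V → Fin V
  step i v = other src tgt (edgeAt i v) v

  field
    -- for distinct colours i, j the i/j-edges form disjoint 4-cycles:
    -- alternating i, j, i, j from any vertex returns to it
    square : ∀ i j v → i ≢ j → step j (step i (step j (step i v))) ≡ v

  sqEdge1 sqEdge2 sqEdge3 sqEdge4 : Fin n → Fin n → Fin V → Fin E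
  sqEdge1 i j v = edgeAt i v
  sqEdge2 i j v = edgeAt j (step i v)
  sqEdge3 i j v = edgeAt i (step j (step i v))
  sqEdge4 i j v = edgeAt j (step i (step j (step i v)))


module _ {n : ℕ} (A : Chromotopology n) where
  open Chromotopology A

  -- dashings: maps E(A) → ℤ₂, with ℤ₂ represented by Bool (true = 1, xor = +)
  Dashing : Set
  Dashing = Fin E → Bool

  sqSum : Dashing → Fin n → Fin n → Fin V → Bool
  sqSum d i j v = d (sqEdge1 i j v) xor d (sqEdge2 i j v) xor d (sqEdge3 i j v) xor d (sqEdge4 i j v)

  -- every 2-coloured 4-cycle arises as the (i,j)-cycle through one of its vertices
  IsOdd : Dashing → Set
  IsOdd d = ∀ i j v → i ≢ j → sqSum d i j v ≡ true

  IsEven : Dashing → Set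
  IsEven d = ∀ i j v → i ≢ j → sqSum d i j v ≡ false

  IsRanking : (Fin V → ℤ) → Set
  IsRanking h = ∀ e → ∣ h (src e) - h (tgt e) ∣ ≡ 1

  Adinkraizable : Set
  Adinkraizable = (∃ λ d → IsOdd d) × (∃ λ h → IsRanking h)

  isOdd? : (d : Dashing) → Dec (IsOdd d)
  isOdd? d = all? λ i → all? λ j → all? λ v → ¬? (i ≟ j) →-dec (sqSum d i j v ≟B true)

  isEven? : (d : Dashing) → Dec (IsEven d)
  isEven? d = all? λ i → all? λ j → all? λ v → ¬? (i ≟ j) →-dec (sqSum d i j v ≟B false)

-- list of all functions Fin m → Bool (each exactly once, up to pointwise equality)
allBoolFuns : (m : ℕ) → List (Fin m → Bool)
allBoolFuns zero = (λ ()) ∷ []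
allBoolFuns (suc m) = map (λ f → cons false f) (allBoolFuns m) ++ map (λ f → cons true f) (allBoolFuns m)
  where
  cons : Bool → (Fin m → Bool) → Fin (suc m) → Bool
  cons b f zero = b
  cons b f (suc k) = f k

numOdd : {n : ℕ} → Chromotopology n → ℕ
numOdd A = length (filter (isOdd? A) (allBoolFuns (Chromotopology.E A)))

numEven : {n : ℕ} → Chromotopology n → ℕ
numEven A = length (filter (isEven? A) (allBoolFuns (Chromotopology.E A)))

-- Adding a fixed odd dashing b changes the sum over every 2-coloured 4-cycle by 1, because that
-- sum is ℤ₂-linear in the dashing.  Hence d ↦ d + b maps e(A) onto o(A), and it is a bijection
-- since it is its own inverse; on the list of all dashings this is a translation, which does not
-- change the number of dashings satisfying a predicate.
module Submission where

open import Defs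
open import Level using (0ℓ)
open import Function using (_∘_)
open import Data.Nat using (ℕ; zero; suc; _+_)
open import Data.Nat.Properties using (+-comm)
open import Data.Fin using (zero; suc)
open import Data.Bool using (Bool; true; false; not; _xor_)
open import Data.Bool.Properties using (xor-∧-commutativeRing; xor-assoc; xor-same; xor-identityʳ)
open import Data.List using (List; []; _∷_; _++_; map; filter; length)
open import Data.List.Properties using (filter-++; filter-≐; length-++)
open import Data.Product using (_,_)
open import Data.Vec.Functional as Vector using (Vector; head; tail; zipWith)
open import Relation.Nullary using (does)
open import Relation.Unary using (Pred; Decidable; _≐_)
open import Relation.Binary.PropositionalEquality
  using (_≡_; refl; sym; trans; cong; cong₂; _≗_; module ≡-Reasoning)
open import Algebra.Bundles using (CommutativeRing)
open import Algebra.Properties.CommutativeSemigroup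
  (CommutativeRing.+-commutativeSemigroup xor-∧-commutativeRing) using (interchange)

count : {A : Set} {P : Pred A 0ℓ} → Decidable P → List A → ℕ
count P? = length ∘ filter P?

module _ {A : Set} {P : Pred A 0ℓ} (P? : Decidable P) where

  count-++ : (xs ys : List A) → count P? (xs ++ ys) ≡ count P? xs + count P? ys
  count-++ xs ys = trans (cong length (filter-++ P? xs ys)) (length-++ (filter P? xs))

  count-map : {B : Set} (f : B → A) (xs : List B) → count P? (map f xs) ≡ count (P? ∘ f) xs
  count-map f [] = refl
  count-map f (x ∷ xs) with does (P? (f x))
  ... | true  = cong suc (count-map f xs)
  ... | false = count-map f xs

  count-≐ : {Q : Pred A 0ℓ} (Q? : Decidable Q) → P ≐ Q → (xs : List A) → count P? xs ≡ count Q? xs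
  count-≐ Q? P≐Q xs = cong length (filter-≐ P? Q? P≐Q xs)

Extensional : {m : ℕ} → Pred (Vector Bool m) 0ℓ → Set
Extensional P = ∀ {f g} → f ≗ g → P f → P g

≗⇒≐ : {B : Set} {m : ℕ} {P : Pred (Vector Bool m) 0ℓ} {f g : B → Vector Bool m} →
      Extensional P → (∀ d → f d ≗ g d) → (P ∘ f) ≐ (P ∘ g)
≗⇒≐ ext f≗g = (λ {d} → ext (f≗g d)) , (λ {d} → ext (sym ∘ f≗g d))

infixl 6 _⊕_

_⊕_ : {m : ℕ} → Vector Bool m → Vector Bool m → Vector Bool m
_⊕_ = zipWith _xor_

⊕-cancelʳ : {m : ℕ} (d b : Vector Bool m) → (d ⊕ b) ⊕ b ≗ d
⊕-cancelʳ d b k = begin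
  (d k xor b k) xor b k  ≡⟨ xor-assoc (d k) (b k) (b k) ⟩
  d k xor (b k xor b k)  ≡⟨ cong (d k xor_) (xor-same (b k)) ⟩
  d k xor false          ≡⟨ xor-identityʳ (d k) ⟩
  d k                    ∎
  where open ≡-Reasoning

⊕-extensional : {m : ℕ} {P : Pred (Vector Bool m) 0ℓ} (b : Vector Bool m) →
                Extensional P → Extensional (P ∘ (_⊕ b))
⊕-extensional b ext f≗g = ext (λ k → cong (_xor b k) (f≗g k))

⊕-∷ : {m : ℕ} (c : Bool) (d : Vector Bool m) (b : Vector Bool (suc m)) →
      (c Vector.∷ d) ⊕ b ≗ (c xor head b) Vector.∷ (d ⊕ tail b)
⊕-∷ c d b zero    = refl
⊕-∷ c d b (suc k) = refl

∷-extensional : {m : ℕ} {P : Pred (Vector Bool (suc m)) 0ℓ} (c : Bool) →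
                Extensional P → Extensional (P ∘ (c Vector.∷_))
∷-extensional c ext f≗g = ext λ { zero → refl ; (suc k) → f≗g k }

count-map-≗ : {B : Set} {m : ℕ} {P : Pred (Vector Bool m) 0ℓ} (P? : Decidable P) → Extensional P →
              {f g : B → Vector Bool m} → (∀ x → f x ≗ g x) → (xs : List B) →
              count P? (map f xs) ≡ count (P? ∘ g) xs
count-map-≗ P? ext {f} {g} f≗g xs =
  trans (count-map P? f xs) (count-≐ (P? ∘ f) (P? ∘ g) (≗⇒≐ ext f≗g) xs)

count-allBoolFuns-suc : {m : ℕ} {P : Pred (Vector Bool (suc m)) 0ℓ} (P? : Decidable P) →
  Extensional P → count P? (allBoolFuns (suc m))
  ≡ count (P? ∘ (false Vector.∷_)) (allBoolFuns m) + count (P? ∘ (true Vector.∷_)) (allBoolFuns m)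
count-allBoolFuns-suc {m} P? ext =
  split (λ { _ zero → refl ; _ (suc _) → refl }) (λ { _ zero → refl ; _ (suc _) → refl })
  where
  -- allBoolFuns prepends with its own local cons, equal to Vector._∷_ only pointwise;
  -- abstracting over it lets unification recover it from the goal.
  split : {f g : Vector Bool m → Vector Bool (suc m)} →
          (∀ d → f d ≗ false Vector.∷ d) → (∀ d → g d ≗ true Vector.∷ d) →
          count P? (map f (allBoolFuns m) ++ map g (allBoolFuns m))
          ≡ count (P? ∘ (false Vector.∷_)) (allBoolFuns m) + count (P? ∘ (true Vector.∷_)) (allBoolFuns m)
  split {f} {g} f≗ g≗ =
    trans (count-++ P? (map f (allBoolFuns m)) (map g (allBoolFuns m)))
          (cong₂ _+_ (count-map-≗ P? ext f≗ (allBoolFuns m)) (count-map-≗ P? ext g≗ (allBoolFuns m)))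

count-translate : (m : ℕ) {P : Pred (Vector Bool m) 0ℓ} (P? : Decidable P) → Extensional P →
  (b : Vector Bool m) → count (P? ∘ (_⊕ b)) (allBoolFuns m) ≡ count P? (allBoolFuns m)
count-translate zero P? ext b = count-≐ (P? ∘ (_⊕ b)) P? (≗⇒≐ ext (λ _ ())) (allBoolFuns zero)
count-translate (suc m) P? ext b = begin
  count (P? ∘ (_⊕ b)) (allBoolFuns (suc m))
    ≡⟨ count-allBoolFuns-suc (P? ∘ (_⊕ b)) (⊕-extensional b ext) ⟩
  countFrom (λ d → (false Vector.∷ d) ⊕ b) + countFrom (λ d → (true Vector.∷ d) ⊕ b)
    ≡⟨ cong₂ _+_ (∷-translate false) (∷-translate true) ⟩
  countFrom (head b Vector.∷_) + countFrom (not (head b) Vector.∷_)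
    ≡⟨ swap (head b) ⟩
  countFrom (false Vector.∷_) + countFrom (true Vector.∷_)
    ≡⟨ count-allBoolFuns-suc P? ext ⟨
  count P? (allBoolFuns (suc m)) ∎
  where
  open ≡-Reasoning
  countFrom : (Vector Bool m → Vector Bool (suc m)) → ℕ
  countFrom f = count (P? ∘ f) (allBoolFuns m)

  ∷-translate : (c : Bool) → countFrom (λ d → (c Vector.∷ d) ⊕ b) ≡ countFrom ((c xor head b) Vector.∷_)
  ∷-translate c = begin
    countFrom (λ d → (c Vector.∷ d) ⊕ b)
      ≡⟨ count-≐ _ (P? ∘ (c′ Vector.∷_) ∘ (_⊕ tail b)) (≗⇒≐ ext (λ d → ⊕-∷ c d b)) (allBoolFuns m) ⟩
    count (P? ∘ (c′ Vector.∷_) ∘ (_⊕ tail b)) (allBoolFuns m)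
      ≡⟨ count-translate m (P? ∘ (c′ Vector.∷_)) (∷-extensional c′ ext) (tail b) ⟩
    countFrom (c′ Vector.∷_) ∎
    where
    c′ : Bool
    c′ = c xor head b

  swap : (c : Bool) → countFrom (c Vector.∷_) + countFrom (not c Vector.∷_)
                    ≡ countFrom (false Vector.∷_) + countFrom (true Vector.∷_)
  swap false = refl
  swap true  = +-comm (countFrom (true Vector.∷_)) (countFrom (false Vector.∷_))

xor-interchange₄ : ∀ a₁ a₂ a₃ a₄ b₁ b₂ b₃ b₄ →
  (a₁ xor b₁) xor (a₂ xor b₂) xor (a₃ xor b₃) xor (a₄ xor b₄)
  ≡ (a₁ xor a₂ xor a₃ xor a₄) xor (b₁ xor b₂ xor b₃ xor b₄)
xor-interchange₄ a₁ a₂ a₃ a₄ b₁ b₂ b₃ b₄ = begin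
  (a₁ xor b₁) xor (a₂ xor b₂) xor (a₃ xor b₃) xor (a₄ xor b₄)
    ≡⟨ cong (λ z → (a₁ xor b₁) xor (a₂ xor b₂) xor z) (interchange a₃ b₃ a₄ b₄) ⟩
  (a₁ xor b₁) xor (a₂ xor b₂) xor (a₃ xor a₄) xor (b₃ xor b₄)
    ≡⟨ cong ((a₁ xor b₁) xor_) (interchange a₂ b₂ (a₃ xor a₄) (b₃ xor b₄)) ⟩
  (a₁ xor b₁) xor (a₂ xor a₃ xor a₄) xor (b₂ xor b₃ xor b₄)
    ≡⟨ interchange a₁ b₁ (a₂ xor a₃ xor a₄) (b₂ xor b₃ xor b₄) ⟩
  (a₁ xor a₂ xor a₃ xor a₄) xor (b₁ xor b₂ xor b₃ xor b₄) ∎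
  where open ≡-Reasoning

module _ {n : ℕ} (A : Chromotopology n) where
  open Chromotopology A using (sqEdge1; sqEdge2; sqEdge3; sqEdge4)

  sqSum-⊕ : ∀ d b i j v → sqSum A (d ⊕ b) i j v ≡ sqSum A d i j v xor sqSum A b i j v
  sqSum-⊕ d b i j v = xor-interchange₄
    (d (sqEdge1 i j v)) (d (sqEdge2 i j v)) (d (sqEdge3 i j v)) (d (sqEdge4 i j v))
    (b (sqEdge1 i j v)) (b (sqEdge2 i j v)) (b (sqEdge3 i j v)) (b (sqEdge4 i j v))

  sqSum-cong : ∀ {d d′} → d ≗ d′ → ∀ i j v → sqSum A d i j v ≡ sqSum A d′ i j v
  sqSum-cong d≗d′ i j v =
    cong₂ _xor_ (d≗d′ _) (cong₂ _xor_ (d≗d′ _) (cong₂ _xor_ (d≗d′ _) (d≗d′ _)))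

  isOdd-extensional : Extensional (IsOdd A)
  isOdd-extensional d≗d′ odd i j v i≢j = trans (sym (sqSum-cong d≗d′ i j v)) (odd i j v i≢j)

  isEven-extensional : Extensional (IsEven A)
  isEven-extensional d≗d′ even i j v i≢j = trans (sym (sqSum-cong d≗d′ i j v)) (even i j v i≢j)

  even-⊕-odd : ∀ {d b} → IsEven A d → IsOdd A b → IsOdd A (d ⊕ b)
  even-⊕-odd {d} {b} even odd i j v i≢j =
    trans (sqSum-⊕ d b i j v) (cong₂ _xor_ (even i j v i≢j) (odd i j v i≢j))

  odd-⊕-odd : ∀ {d b} → IsOdd A d → IsOdd A b → IsEven A (d ⊕ b)
  odd-⊕-odd {d} {b} odd₁ odd₂ i j v i≢j =
    trans (sqSum-⊕ d b i j v) (cong₂ _xor_ (odd₁ i j v i≢j) (odd₂ i j v i≢j))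

  isEven≐isOdd-⊕ : ∀ b → IsOdd A b → IsEven A ≐ (IsOdd A ∘ (_⊕ b))
  isEven≐isOdd-⊕ b b-odd =
    (λ {d} even → even-⊕-odd {d} {b} even b-odd) ,
    (λ {d} d⊕b-odd → isEven-extensional (⊕-cancelʳ d b) (odd-⊕-odd {d ⊕ b} {b} d⊕b-odd b-odd))

mainTheorem15 : {n : ℕ} (A : Chromotopology n) → Adinkraizable A → numOdd A ≡ numEven A
mainTheorem15 A ((b , b-odd) , _) = begin
  numOdd A
    ≡⟨ count-translate E (isOdd? A) (isOdd-extensional A) b ⟨
  count (isOdd? A ∘ (_⊕ b)) (allBoolFuns E)
    ≡⟨ count-≐ (isEven? A) (isOdd? A ∘ (_⊕ b)) (isEven≐isOdd-⊕ A b b-odd) (allBoolFuns E) ⟨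
  numEven A ∎
  where
  open Chromotopology A using (E)
  open ≡-Reasoning
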